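{- Let $g$ be a non-negative integer. (1) Let $n\geq 5$ and let $W_n$ be the wheel of order $n$. Then $W_n$ has an $R_g$-cutset if and only if $0\leq g\leq \lfloor \frac{n-5}{2}\rfloor$, and in that case $\kappa_g(W_n)=3$. (2) Let $n\geq 3$ and let $P_n$ be the path of order $n$. Then $P_n$ has an $R_g$-cutset if and only if $0\leq g\leq \lfloor \frac{n-3}{2}\rfloor$, and in that case $\kappa_g(P_n)=1$.
   Context: The wheel $W_n$ of order $n$ consists of a cycle $C_{n-1}$ together with one additional vertex (the center) adjacent to all vertices of the cycle. A set $S$ of vertices is a cutset if $G-S$ is disconnected; for a non-negative integer $g$, a cutset is an $R_g$-cutset if every component of $G-S$ has at least $g+1$ vertices. If $G$ has an $R_g$-cutset, $\kappa_g(G)$ is the minimum cardinality of an $R_g$-cutset of $G$. -}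

module Defs where

open import Data.Nat using (ℕ; zero; suc; _∸_; _≤_)
open import Data.Fin using (Fin; toℕ)
open import Data.Fin.Subset using (Subset; _∈_; _∉_; ∣_∣)
open import Data.Product using (Σ; ∃; _×_)
open import Data.Sum using (_⊎_)
open import Data.Unit using (⊤)
open import Data.Empty using (⊥)
open import Function.Definitions using (Injective)
open import Relation.Binary.PropositionalEquality using (_≡_)
open import Relation.Nullary using (¬_)

Graph : ℕ → Set₁
Graph n = Fin n → Fin n → Set

CycAdjℕ : ℕ → ℕ → ℕ → Set
CycAdjℕ m a b = (suc a ≡ b) ⊎ (suc b ≡ a) ⊎ ((a ≡ 0) × (suc b ≡ m)) ⊎ ((b ≡ 0) × (suc a ≡ m))

-- Wheel adjacency: vertex 0 is the center; vertices 1 .. n-1 form the cycle C_{n-1}.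
WheelAdjℕ : ℕ → ℕ → ℕ → Set
WheelAdjℕ n zero zero = ⊥
WheelAdjℕ n zero (suc b) = ⊤
WheelAdjℕ n (suc a) zero = ⊤
WheelAdjℕ n (suc a) (suc b) = CycAdjℕ (n ∸ 1) a b

Wheel : (n : ℕ) → Graph n
Wheel n x y = WheelAdjℕ n (toℕ x) (toℕ y)

PathG : (n : ℕ) → Graph n
PathG n x y = (suc (toℕ x) ≡ toℕ y) ⊎ (suc (toℕ y) ≡ toℕ x)

-- Connectivity in G - S: a walk from u to v all of whose vertices avoid S.
data ConnAvoid {n : ℕ} (G : Graph n) (S : Subset n) : Fin n → Fin n → Set where
  here : ∀ {u} → u ∉ S → ConnAvoid G S u u
  step : ∀ {u w v} → u ∉ S → G u w → ConnAvoid G S w v → ConnAvoid G S u v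

IsCutset : {n : ℕ} → Graph n → Subset n → Set
IsCutset {n} G S = Σ (Fin n) λ u → Σ (Fin n) λ v →
  (u ∉ S) × (v ∉ S) × ¬ ConnAvoid G S u v

ComponentAtLeast : {n : ℕ} → Graph n → Subset n → Fin n → ℕ → Set
ComponentAtLeast {n} G S u k =
  Σ (Fin k → Fin n) λ f → Injective _≡_ _≡_ f × (∀ i → ConnAvoid G S u (f i))

IsRgCutset : {n : ℕ} → Graph n → ℕ → Subset n → Set
IsRgCutset {n} G g S = IsCutset G S × (∀ u → u ∉ S → ComponentAtLeast G S u (suc g))

HasRgCutset : {n : ℕ} → Graph n → ℕ → Set
HasRgCutset {n} G g = Σ (Subset n) λ S → IsRgCutset G g S

KappaIs : {n : ℕ} → Graph n → ℕ → ℕ → Set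
KappaIs {n} G g k =
  (Σ (Subset n) λ S → IsRgCutset G g S × (∣ S ∣ ≡ k)) ×
  (∀ S → IsRgCutset G g S → k ≤ ∣ S ∣)

-- Every R_g-cutset S leaves two components of at least g+1 vertices each, so
-- 2(g+1) ≤ n − |S|.  In P_n a cutset is nonempty; in W_n it must contain the
-- center (otherwise everything is joined through it) and, for two separated rim
-- vertices u ≤ v, a vertex on each of the rim arcs u…v and v…n−1,1…u, hence
-- |S| ≥ 3.  Conversely {g+1} in P_n and {center, 1, g+3} in W_n are R_g-cutsets
-- of these sizes as soon as there is room for two runs of g+1 vertices, i.e.
-- |S| + 2(g+1) ≤ n, which is the condition g ≤ ⌊(n − |S| − 2)/2⌋.

module Submission where

open import Defs
open import Data.Nat using (ℕ; zero; suc; _+_; _*_; _∸_; _≤_; _<_; z≤n; s≤s; NonZero)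
open import Data.Nat.Properties
open import Data.Nat.DivMod using (_/_; m*n/n≡m; m/n*n≤m; /-monoˡ-≤)
open import Data.Nat.Tactic.RingSolver using (solve-∀)
open import Data.Fin using (Fin; zero; suc; toℕ; fromℕ; fromℕ<; _↑ʳ_; inject≤; splitAt; join)
open import Data.Fin.Properties
  using (toℕ-injective; toℕ-fromℕ; toℕ-fromℕ<; toℕ<n; ≤fromℕ; toℕ-↑ʳ; toℕ-inject≤;
         ↑ʳ-injective; inject≤-injective; join-splitAt)
  renaming (suc-injective to fsuc-injective; 0≢1+n to fzero≢fsuc)
open import Data.Fin.Subset using (Subset; _∈_; _∉_; ∣_∣; ⁅_⁆; _─_; _∪_; ∁; inside; outside)
open import Data.Fin.Subset.Properties
  using (_∈?_; x∈⁅x⁆; x∈⁅y⁆⇒x≡y; x≢y⇒x∉⁅y⁆; ∣⁅x⁆∣≡1; x∈p∧x∉q⇒x∈p─q; x∈p∩q⁺;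
         p∩q≢∅⇒∣p─q∣<∣p∣; x∈p∪q⁻; x∈p∪q⁺; x∉p⇒x∈∁p; ∣∁p∣≡n∸∣p∣; ∣p∣≤n)
open import Data.Vec using (_∷_; [])
open import Data.Product using (Σ-syntax; ∃; _,_; proj₁; proj₂; _×_)
open import Data.Sum as Sum using (_⊎_; inj₁; inj₂; [_,_]′)
open import Data.Empty using (⊥; ⊥-elim)
open import Data.Unit using (tt)
open import Function using (_∘_; id)
open import Function.Definitions using (Injective)
open import Function.Bundles using (_⇔_; mk⇔; Equivalence)
open import Function.Construct.Composition using (_⇔-∘_)
open import Function.Construct.Symmetry using (⇔-sym)
open import Relation.Binary.Definitions using (Symmetric)
open import Relation.Binary.PropositionalEquality
open import Relation.Nullary using (¬_; yes; no)

-- Walks avoiding a set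

module _ {n : ℕ} {G : Graph n} {S : Subset n} where

  ConnAvoid-source : ∀ {u v} → ConnAvoid G S u v → u ∉ S
  ConnAvoid-source (here u∉S)     = u∉S
  ConnAvoid-source (step u∉S _ _) = u∉S

  ConnAvoid-target : ∀ {u v} → ConnAvoid G S u v → v ∉ S
  ConnAvoid-target (here v∉S)   = v∉S
  ConnAvoid-target (step _ _ c) = ConnAvoid-target c

  ConnAvoid-trans : ∀ {u w v} → ConnAvoid G S u w → ConnAvoid G S w v → ConnAvoid G S u v
  ConnAvoid-trans (here _)       d = d
  ConnAvoid-trans (step u∉S e c) d = step u∉S e (ConnAvoid-trans c d)

  ConnAvoid-sym : Symmetric G → ∀ {u v} → ConnAvoid G S u v → ConnAvoid G S v u
  ConnAvoid-sym G-sym (here u∉S)     = here u∉S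
  ConnAvoid-sym G-sym (step u∉S e c) =
    ConnAvoid-trans (ConnAvoid-sym G-sym c) (step (ConnAvoid-source c) (G-sym e) (here u∉S))

  ConnAvoid-preserves : (P : Fin n → Set) →
    (∀ {x w} → x ∉ S → w ∉ S → G x w → P x → P w) →
    ∀ {u v} → ConnAvoid G S u v → P u → P v
  ConnAvoid-preserves P closed (here _)       Pu = Pu
  ConnAvoid-preserves P closed (step u∉S e c) Pu =
    ConnAvoid-preserves P closed c (closed u∉S (ConnAvoid-source c) e Pu)

  separated-below : ∀ c → (∀ {x w} → x ∉ S → w ∉ S → G x w → toℕ x < c → toℕ w < c) →
    ∀ {u v} → toℕ u < c → c ≤ toℕ v → ¬ ConnAvoid G S u v
  separated-below c closed u<c c≤v u~v =
    <⇒≱ (ConnAvoid-preserves (λ x → toℕ x < c) closed u~v u<c) c≤v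

  cutset-wlog : Symmetric G → {P : Set} →
    (∀ {u v} → u ∉ S → v ∉ S → ¬ ConnAvoid G S u v → toℕ u ≤ toℕ v → P) →
    IsCutset G S → P
  cutset-wlog G-sym k (u , v , u∉S , v∉S , ¬u~v) with ≤-total (toℕ u) (toℕ v)
  ... | inj₁ u≤v = k u∉S v∉S ¬u~v u≤v
  ... | inj₂ v≤u = k v∉S u∉S (¬u~v ∘ ConnAvoid-sym G-sym) v≤u

-- Graphs containing the path lo, lo+1, …, n-1

ConsecutiveAdjacent : ∀ {n} → ℕ → Graph n → Set
ConsecutiveAdjacent lo G = ∀ x y → lo ≤ toℕ x → suc (toℕ x) ≡ toℕ y → G x y

MeetsInterval : ∀ {n} → Subset n → Fin n → Fin n → Set
MeetsInterval S x y = ∃ λ z → z ∈ S × toℕ x ≤ toℕ z × toℕ z ≤ toℕ y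

AvoidsInterval : ∀ {n} → Subset n → ℕ → ℕ → Set
AvoidsInterval S a b = ∀ z → a ≤ toℕ z → toℕ z < b → z ∉ S

module _ {n : ℕ} {G : Graph n} {S : Subset n} {lo : ℕ} (adj : ConsecutiveAdjacent lo G) where

  private
    walk : ∀ d x y → toℕ x + d ≡ toℕ y → lo ≤ toℕ x → ConnAvoid G S x y ⊎ MeetsInterval S x y
    walk d x y x+d≡y lo≤x with x ∈? S
    ... | yes x∈S = inj₂ (x , x∈S , ≤-refl , subst (toℕ x ≤_) x+d≡y (m≤m+n (toℕ x) d))
    walk zero x y x+0≡y lo≤x | no x∉S =
      inj₁ (subst (ConnAvoid G S x) (toℕ-injective (trans (sym (+-identityʳ _)) x+0≡y)) (here x∉S))
    walk (suc d) x y x+d≡y lo≤x | no x∉S =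
      Sum.map (step x∉S (adj x x′ lo≤x (sym x′≡1+x))) later (walk d x′ y x′+d≡y lo≤x′)
      where
      1+x<n : suc (toℕ x) < n
      1+x<n = ≤-<-trans (≤-trans (s≤s (m≤m+n (toℕ x) d)) (≤-reflexive (sym (+-suc (toℕ x) d))))
                        (subst (_< n) (sym x+d≡y) (toℕ<n y))
      x′ : Fin n
      x′ = fromℕ< 1+x<n
      x′≡1+x : toℕ x′ ≡ suc (toℕ x)
      x′≡1+x = toℕ-fromℕ< 1+x<n
      x′+d≡y : toℕ x′ + d ≡ toℕ y
      x′+d≡y = trans (cong (_+ d) x′≡1+x) (trans (sym (+-suc (toℕ x) d)) x+d≡y)
      lo≤x′ : lo ≤ toℕ x′
      lo≤x′ = ≤-trans lo≤x (≤-trans (n≤1+n (toℕ x)) (≤-reflexive (sym x′≡1+x)))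
      later : MeetsInterval S x′ y → MeetsInterval S x y
      later (z , z∈S , x′≤z , z≤y) =
        z , z∈S , ≤-trans (n≤1+n (toℕ x)) (subst (_≤ toℕ z) x′≡1+x x′≤z) , z≤y

  connected⊎meets : ∀ {x y} → lo ≤ toℕ x → toℕ x ≤ toℕ y → ConnAvoid G S x y ⊎ MeetsInterval S x y
  connected⊎meets {x} {y} lo≤x x≤y = walk (toℕ y ∸ toℕ x) x y (m+[n∸m]≡n x≤y) lo≤x

  connected-if-avoids : ∀ {a b} → lo ≤ a → AvoidsInterval S a b →
    ∀ {x y} → a ≤ toℕ x → toℕ y < b → toℕ x ≤ toℕ y → ConnAvoid G S x y
  connected-if-avoids lo≤a avoids a≤x y<b x≤y =
    [ id , (λ { (z , z∈S , x≤z , z≤y) → ⊥-elim (avoids z (≤-trans a≤x x≤z) (≤-<-trans z≤y y<b) z∈S) }) ]′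
      (connected⊎meets (≤-trans lo≤a a≤x) x≤y)

  interval-connected : Symmetric G → ∀ {a b} → lo ≤ a → AvoidsInterval S a b →
    ∀ {x y} → a ≤ toℕ x → toℕ x < b → a ≤ toℕ y → toℕ y < b → ConnAvoid G S x y
  interval-connected G-sym lo≤a avoids {x} {y} a≤x x<b a≤y y<b with ≤-total (toℕ x) (toℕ y)
  ... | inj₁ x≤y = connected-if-avoids lo≤a avoids a≤x y<b x≤y
  ... | inj₂ y≤x = ConnAvoid-sym G-sym (connected-if-avoids lo≤a avoids a≤y x<b y≤x)

  interval-component : Symmetric G → ∀ {a b k} → lo ≤ a → a + k ≤ b → b ≤ n → AvoidsInterval S a b →
    ∀ {x} → a ≤ toℕ x → toℕ x < b → ComponentAtLeast G S x k
  interval-component G-sym {a} {b} {k} lo≤a a+k≤b b≤n avoids a≤x x<b = member , member-injective , reach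
    where
    member : Fin k → Fin n
    member i = inject≤ (a ↑ʳ i) (≤-trans a+k≤b b≤n)
    toℕ-member : ∀ i → toℕ (member i) ≡ a + toℕ i
    toℕ-member i = trans (toℕ-inject≤ (a ↑ʳ i) _) (toℕ-↑ʳ a i)
    member-injective : Injective _≡_ _≡_ member
    member-injective {i} {j} eq = ↑ʳ-injective a i j (inject≤-injective _ _ _ _ eq)
    reach : ∀ i → ConnAvoid G S _ (member i)
    reach i = interval-connected G-sym lo≤a avoids a≤x x<b
      (subst (a ≤_) (sym (toℕ-member i)) (m≤m+n a (toℕ i)))
      (subst (_< b) (sym (toℕ-member i)) (<-≤-trans (+-monoʳ-< a (toℕ<n i)) a+k≤b))

-- Counting elements of a subset

module _ {n : ℕ} where

  ∣p─⁅x⁆∣<∣p∣ : ∀ {p : Subset n} {x} → x ∈ p → ∣ p ─ ⁅ x ⁆ ∣ < ∣ p ∣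
  ∣p─⁅x⁆∣<∣p∣ {p} {x} x∈p = p∩q≢∅⇒∣p─q∣<∣p∣ p ⁅ x ⁆ (x , x∈p∩q⁺ (x∈p , x∈⁅x⁆ x))

  x∈p∧x≢y⇒x∈p─⁅y⁆ : ∀ {p : Subset n} {x y} → x ∈ p → x ≢ y → x ∈ p ─ ⁅ y ⁆
  x∈p∧x≢y⇒x∈p─⁅y⁆ x∈p x≢y = x∈p∧x∉q⇒x∈p─q x∈p (x≢y⇒x∉⁅y⁆ x≢y)

  injection⇒≤∣p∣ : ∀ {j} {p : Subset n} (f : Fin j → Fin n) → Injective _≡_ _≡_ f →
    (∀ i → f i ∈ p) → j ≤ ∣ p ∣
  injection⇒≤∣p∣ {zero}  f f-inj f∈p = z≤n
  injection⇒≤∣p∣ {suc j} f f-inj f∈p = ≤-<-trans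
    (injection⇒≤∣p∣ (f ∘ suc) (fsuc-injective ∘ f-inj)
      (λ i → x∈p∧x≢y⇒x∈p─⁅y⁆ (f∈p (suc i)) (fzero≢fsuc ∘ sym ∘ f-inj)))
    (∣p─⁅x⁆∣<∣p∣ (f∈p zero))

  disjoint-injections⇒≤∣p∣ : ∀ {j k} {p : Subset n} (f : Fin j → Fin n) (h : Fin k → Fin n) →
    Injective _≡_ _≡_ f → Injective _≡_ _≡_ h → (∀ i i′ → f i ≢ h i′) →
    (∀ i → f i ∈ p) → (∀ i → h i ∈ p) → j + k ≤ ∣ p ∣
  disjoint-injections⇒≤∣p∣ {j} {k} {p} f h f-inj h-inj disjoint f∈p h∈p =
    injection⇒≤∣p∣ ([ f , h ]′ ∘ splitAt j) (splitAt-injective ∘ copair-injective)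
      (λ i → [,]-∈ (splitAt j i))
    where
    splitAt-injective : ∀ {a b} → splitAt j a ≡ splitAt j b → a ≡ b
    splitAt-injective {a} {b} eq =
      trans (sym (join-splitAt j k a)) (trans (cong (join j k) eq) (join-splitAt j k b))
    copair-injective : ∀ {a b} → [ f , h ]′ a ≡ [ f , h ]′ b → a ≡ b
    copair-injective {inj₁ i} {inj₁ i′} eq = cong inj₁ (f-inj eq)
    copair-injective {inj₁ i} {inj₂ i′} eq = ⊥-elim (disjoint i i′ eq)
    copair-injective {inj₂ i} {inj₁ i′} eq = ⊥-elim (disjoint i′ i (sym eq))
    copair-injective {inj₂ i} {inj₂ i′} eq = cong inj₂ (h-inj eq)
    [,]-∈ : ∀ a → [ f , h ]′ a ∈ p
    [,]-∈ (inj₁ i) = f∈p i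
    [,]-∈ (inj₂ i) = h∈p i

  three-distinct⇒3≤∣p∣ : ∀ {p : Subset n} {a b c} → a ∈ p → b ∈ p → c ∈ p →
    a ≢ b → a ≢ c → b ≢ c → 3 ≤ ∣ p ∣
  three-distinct⇒3≤∣p∣ a∈p b∈p c∈p a≢b a≢c b≢c =
    ≤-<-trans (≤-<-trans (≤-<-trans z≤n
      (∣p─⁅x⁆∣<∣p∣ (x∈p∧x≢y⇒x∈p─⁅y⁆ (x∈p∧x≢y⇒x∈p─⁅y⁆ c∈p (a≢c ∘ sym)) (b≢c ∘ sym))))
      (∣p─⁅x⁆∣<∣p∣ (x∈p∧x≢y⇒x∈p─⁅y⁆ b∈p (a≢b ∘ sym))))
      (∣p─⁅x⁆∣<∣p∣ a∈p)

∣p∪q∣≤∣p∣+∣q∣ : ∀ {n} (p q : Subset n) → ∣ p ∪ q ∣ ≤ ∣ p ∣ + ∣ q ∣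
∣p∪q∣≤∣p∣+∣q∣ []            []            = z≤n
∣p∪q∣≤∣p∣+∣q∣ (inside  ∷ p) (inside  ∷ q) = s≤s (≤-trans (∣p∪q∣≤∣p∣+∣q∣ p q) (+-monoʳ-≤ ∣ p ∣ (n≤1+n ∣ q ∣)))
∣p∪q∣≤∣p∣+∣q∣ (inside  ∷ p) (outside ∷ q) = s≤s (∣p∪q∣≤∣p∣+∣q∣ p q)
∣p∪q∣≤∣p∣+∣q∣ (outside ∷ p) (inside  ∷ q) = ≤-trans (s≤s (∣p∪q∣≤∣p∣+∣q∣ p q)) (≤-reflexive (sym (+-suc ∣ p ∣ ∣ q ∣)))
∣p∪q∣≤∣p∣+∣q∣ (outside ∷ p) (outside ∷ q) = ∣p∪q∣≤∣p∣+∣q∣ p q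

module _ {n k : ℕ} (k<n : k < n) {x : Fin n} where

  toℕ≢⇒∉⁅fromℕ<⁆ : toℕ x ≢ k → x ∉ ⁅ fromℕ< k<n ⁆
  toℕ≢⇒∉⁅fromℕ<⁆ x≢k x∈ = x≢k (trans (cong toℕ (x∈⁅y⁆⇒x≡y _ x∈)) (toℕ-fromℕ< k<n))

  ∉⁅fromℕ<⁆⇒toℕ≢ : x ∉ ⁅ fromℕ< k<n ⁆ → toℕ x ≢ k
  ∉⁅fromℕ<⁆⇒toℕ≢ x∉ x≡k =
    x∉ (subst (_∈ ⁅ fromℕ< k<n ⁆) (toℕ-injective (trans (toℕ-fromℕ< k<n) (sym x≡k))) (x∈⁅x⁆ _))

module _ {n : ℕ} {p q : Subset n} {x : Fin n} where

  x∉p∪q⁺ : x ∉ p → x ∉ q → x ∉ p ∪ q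
  x∉p∪q⁺ x∉p x∉q = [ x∉p , x∉q ]′ ∘ x∈p∪q⁻ p q

  x∉p∪q⁻ : x ∉ p ∪ q → x ∉ p × x ∉ q
  x∉p∪q⁻ x∉ = x∉ ∘ x∈p∪q⁺ ∘ inj₁ , x∉ ∘ x∈p∪q⁺ ∘ inj₂

-- The path and the wheel

step-stays-below : ∀ {a b c} → suc a ≡ b ⊎ suc b ≡ a → b ≢ c → a < c → b < c
step-stays-below (inj₁ refl) b≢c a<c = ≤∧≢⇒< a<c b≢c
step-stays-below (inj₂ refl) b≢c a<c = <-trans (n<1+n _) a<c

path-sym : ∀ {n} → Symmetric (PathG n)
path-sym (inj₁ e) = inj₂ e
path-sym (inj₂ e) = inj₁ e

path-consecutive : ∀ {n} → ConsecutiveAdjacent 0 (PathG n)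
path-consecutive x y _ = inj₁

wheel-sym : ∀ {n} → Symmetric (Wheel n)
wheel-sym {n} {x} {y} = sym-ℕ (toℕ x) (toℕ y)
  where
  sym-ℕ : ∀ a b → WheelAdjℕ n a b → WheelAdjℕ n b a
  sym-ℕ zero    (suc b) _ = tt
  sym-ℕ (suc a) zero    _ = tt
  sym-ℕ (suc a) (suc b) (inj₁ e)                 = inj₂ (inj₁ e)
  sym-ℕ (suc a) (suc b) (inj₂ (inj₁ e))          = inj₁ e
  sym-ℕ (suc a) (suc b) (inj₂ (inj₂ (inj₁ e)))   = inj₂ (inj₂ (inj₂ e))
  sym-ℕ (suc a) (suc b) (inj₂ (inj₂ (inj₂ e)))   = inj₂ (inj₂ (inj₁ e))

wheel-consecutive : ∀ {n} → ConsecutiveAdjacent 1 (Wheel n)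
wheel-consecutive {n} x y = adjacent-ℕ (toℕ x) (toℕ y)
  where
  adjacent-ℕ : ∀ a b → 1 ≤ a → suc a ≡ b → WheelAdjℕ n a b
  adjacent-ℕ (suc a) (suc b) _ e = inj₁ (suc-injective e)

wheel-rim-adjacent : ∀ {n a b} → 2 ≤ a → 2 ≤ b → WheelAdjℕ n a b → suc a ≡ b ⊎ suc b ≡ a
wheel-rim-adjacent (s≤s (s≤s _)) (s≤s (s≤s _)) (inj₁ e)                 = inj₁ (cong suc e)
wheel-rim-adjacent (s≤s (s≤s _)) (s≤s (s≤s _)) (inj₂ (inj₁ e))          = inj₂ (cong suc e)
wheel-rim-adjacent (s≤s (s≤s _)) (s≤s (s≤s _)) (inj₂ (inj₂ (inj₁ (() , _))))
wheel-rim-adjacent (s≤s (s≤s _)) (s≤s (s≤s _)) (inj₂ (inj₂ (inj₂ (() , _))))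

-- Cutsets

rgCutset⇒2[1+g]≤∣∁S∣ : ∀ {n} {G : Graph n} {g S} → Symmetric G → IsRgCutset G g S →
  suc g + suc g ≤ ∣ ∁ S ∣
rgCutset⇒2[1+g]≤∣∁S∣ {G = G} {S = S} G-sym ((u , v , u∉S , v∉S , ¬u~v) , large)
  with large u u∉S | large v v∉S
... | f , f-inj , u~f | h , h-inj , v~h =
  disjoint-injections⇒≤∣p∣ f h f-inj h-inj disjoint
    (λ i → x∉p⇒x∈∁p (ConnAvoid-target (u~f i))) (λ i → x∉p⇒x∈∁p (ConnAvoid-target (v~h i)))
  where
  disjoint : ∀ i i′ → f i ≢ h i′
  disjoint i i′ fi≡hi′ = ¬u~v (ConnAvoid-trans (u~f i)
    (subst (λ z → ConnAvoid G S z v) (sym fi≡hi′) (ConnAvoid-sym G-sym (v~h i′))))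

path-cutset-size : ∀ {n} (S : Subset n) → IsCutset (PathG n) S → 1 ≤ ∣ S ∣
path-cutset-size S = cutset-wlog path-sym λ _ _ ¬u~v u≤v →
  [ ⊥-elim ∘ ¬u~v , (λ { (z , z∈S , _) → ≤-<-trans z≤n (∣p─⁅x⁆∣<∣p∣ z∈S) }) ]′
    (connected⊎meets path-consecutive z≤n u≤v)

module _ {m : ℕ} {S : Subset (suc (suc m))} (center∈S : zero ∈ S) where

  private
    W : Graph (suc (suc m))
    W = Wheel (suc (suc m))

    1≤toℕ : ∀ {x} → x ∉ S → 1 ≤ toℕ x
    1≤toℕ {zero}  x∉S = ⊥-elim (x∉S center∈S)
    1≤toℕ {suc _} _   = s≤s z≤n

    center≢ : ∀ {x : Fin (suc (suc m))} → 1 ≤ toℕ x → zero ≢ x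
    center≢ 1≤x 0≡x = <⇒≢ 1≤x (cong toℕ 0≡x)

    pinched : ∀ {z x} → z ∈ S → x ∉ S → toℕ z ≤ toℕ x → toℕ x ≤ toℕ z → ⊥
    pinched z∈S x∉S z≤x x≤z = x∉S (subst (_∈ S) (toℕ-injective (≤-antisym z≤x x≤z)) z∈S)

    wrap : W (fromℕ (suc m)) (suc zero)
    wrap = inj₂ (inj₂ (inj₂ (refl , cong suc (toℕ-fromℕ m))))

  rim-cutset-size : ∀ {u v} → u ∉ S → v ∉ S → ¬ ConnAvoid W S u v → toℕ u ≤ toℕ v → 3 ≤ ∣ S ∣
  rim-cutset-size {u} {v} u∉S v∉S ¬u~v u≤v
    with connected⊎meets wheel-consecutive (1≤toℕ u∉S) u≤v
       | connected⊎meets wheel-consecutive (1≤toℕ v∉S) (≤fromℕ v)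
       | connected⊎meets wheel-consecutive {x = suc zero} ≤-refl (1≤toℕ u∉S)
  ... | inj₁ u~v | _ | _ = ⊥-elim (¬u~v u~v)
  ... | inj₂ _ | inj₁ v~last | inj₁ first~u =
    ⊥-elim (¬u~v (ConnAvoid-sym wheel-sym (ConnAvoid-trans v~last (step (ConnAvoid-target v~last) wrap first~u))))
  ... | inj₂ (z , z∈S , u≤z , z≤v) | inj₂ (z′ , z′∈S , v≤z′ , _) | _ =
    three-distinct⇒3≤∣p∣ center∈S z∈S z′∈S
      (center≢ (≤-trans (1≤toℕ u∉S) u≤z)) (center≢ (≤-trans (1≤toℕ v∉S) v≤z′))
      (λ { refl → pinched z∈S v∉S z≤v v≤z′ })
  ... | inj₂ (z , z∈S , u≤z , _) | inj₁ _ | inj₂ (z′ , z′∈S , 1≤z′ , z′≤u) =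
    three-distinct⇒3≤∣p∣ center∈S z∈S z′∈S
      (center≢ (≤-trans (1≤toℕ u∉S) u≤z)) (center≢ 1≤z′)
      (λ { refl → pinched z∈S u∉S z′≤u u≤z })

wheel-cutset-size : ∀ {n} (S : Subset n) → IsCutset (Wheel n) S → 3 ≤ ∣ S ∣
wheel-cutset-size {suc zero} S (zero , zero , u∉S , _ , ¬u~v) = ⊥-elim (¬u~v (here u∉S))
wheel-cutset-size {suc (suc m)} S cut@(u , v , u∉S , v∉S , ¬u~v) with zero ∈? S
... | yes center∈S = cutset-wlog wheel-sym (rim-cutset-size center∈S) cut
... | no center∉S = ⊥-elim (¬u~v (ConnAvoid-trans (to-center u∉S) (ConnAvoid-sym wheel-sym (to-center v∉S))))
  where
  to-center : ∀ {x} → x ∉ S → ConnAvoid (Wheel (suc (suc m))) S x zero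
  to-center {zero}  x∉S = here x∉S
  to-center {suc _} x∉S = step x∉S tt (here center∉S)

path-rgCutset : ∀ {n} g → 1 + (suc g + suc g) ≤ n →
  Σ[ S ∈ Subset n ] IsRgCutset (PathG n) g S × ∣ S ∣ ≤ 1
path-rgCutset {n} g room = ⁅ cut ⁆ , (cutset , components) , ≤-reflexive (∣⁅x⁆∣≡1 cut)
  where
  2+g<n : 2 + g < n
  2+g<n = ≤-trans (s≤s (s≤s (m≤n+m (suc g) g))) room
  1+g<n : suc g < n
  1+g<n = ≤-trans (n≤1+n _) 2+g<n
  0<n : 0 < n
  0<n = ≤-<-trans z≤n 1+g<n
  cut : Fin n
  cut = fromℕ< 1+g<n
  avoid-low : AvoidsInterval ⁅ cut ⁆ 0 (suc g)
  avoid-low z _ z<1+g = toℕ≢⇒∉⁅fromℕ<⁆ 1+g<n (<⇒≢ z<1+g)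
  avoid-high : AvoidsInterval ⁅ cut ⁆ (2 + g) n
  avoid-high z 2+g≤z _ = toℕ≢⇒∉⁅fromℕ<⁆ 1+g<n (>⇒≢ 2+g≤z)
  cutset : IsCutset (PathG n) ⁅ cut ⁆
  cutset = fromℕ< 0<n , fromℕ< 2+g<n ,
    avoid-low _ z≤n (subst (_< suc g) (sym (toℕ-fromℕ< 0<n)) (s≤s z≤n)) ,
    avoid-high _ (≤-reflexive (sym (toℕ-fromℕ< 2+g<n))) (toℕ<n _) ,
    separated-below (suc g)
      (λ _ w∉S e → step-stays-below e (∉⁅fromℕ<⁆⇒toℕ≢ 1+g<n w∉S))
      (subst (_< suc g) (sym (toℕ-fromℕ< 0<n)) (s≤s z≤n))
      (subst (suc g ≤_) (sym (toℕ-fromℕ< 2+g<n)) (n≤1+n _))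
  components : ∀ x → x ∉ ⁅ cut ⁆ → ComponentAtLeast (PathG n) ⁅ cut ⁆ x (suc g)
  components x x∉S with toℕ x <? suc g
  ... | yes x<1+g = interval-component path-consecutive path-sym z≤n ≤-refl (<⇒≤ 1+g<n) avoid-low z≤n x<1+g
  ... | no x≮1+g = interval-component path-consecutive path-sym z≤n room ≤-refl avoid-high
    (≤∧≢⇒< (≮⇒≥ x≮1+g) (∉⁅fromℕ<⁆⇒toℕ≢ 1+g<n x∉S ∘ sym)) (toℕ<n x)

wheel-rgCutset : ∀ {n} g → 3 + (suc g + suc g) ≤ n →
  Σ[ S ∈ Subset n ] IsRgCutset (Wheel n) g S × ∣ S ∣ ≤ 3
wheel-rgCutset {n} g room = S , (cutset , components) , size
  where
  4+g<n : 4 + g < n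
  4+g<n = ≤-trans (s≤s (s≤s (s≤s (s≤s (m≤n+m (suc g) g))))) room
  vertex : ∀ k → k ≤ 4 + g → k < n
  vertex k k≤4+g = ≤-<-trans k≤4+g 4+g<n
  0<n : 0 < n
  0<n = vertex 0 z≤n
  1<n : 1 < n
  1<n = vertex 1 (s≤s z≤n)
  2<n : 2 < n
  2<n = vertex 2 (s≤s (s≤s z≤n))
  3+g<n : 3 + g < n
  3+g<n = vertex (3 + g) (n≤1+n _)
  S : Subset n
  S = ⁅ fromℕ< 0<n ⁆ ∪ (⁅ fromℕ< 1<n ⁆ ∪ ⁅ fromℕ< 3+g<n ⁆)
  off-S : ∀ {x} → x ∉ S → 2 ≤ toℕ x × toℕ x ≢ 3 + g
  off-S x∉S with x∉p∪q⁻ x∉S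
  ... | x∉0 , x∉1∪3+g with x∉p∪q⁻ x∉1∪3+g
  ... | x∉1 , x∉3+g = ≢0∧≢1⇒2≤ (∉⁅fromℕ<⁆⇒toℕ≢ 0<n x∉0) (∉⁅fromℕ<⁆⇒toℕ≢ 1<n x∉1) , ∉⁅fromℕ<⁆⇒toℕ≢ 3+g<n x∉3+g
    where
    ≢0∧≢1⇒2≤ : ∀ {k} → k ≢ 0 → k ≢ 1 → 2 ≤ k
    ≢0∧≢1⇒2≤ {zero}        k≢0 _   = ⊥-elim (k≢0 refl)
    ≢0∧≢1⇒2≤ {suc zero}    _   k≢1 = ⊥-elim (k≢1 refl)
    ≢0∧≢1⇒2≤ {suc (suc _)} _   _   = s≤s (s≤s z≤n)
  on-S : ∀ {x} → 2 ≤ toℕ x → toℕ x ≢ 3 + g → x ∉ S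
  on-S 2≤x x≢3+g = x∉p∪q⁺ (toℕ≢⇒∉⁅fromℕ<⁆ 0<n (>⇒≢ (<-trans (s≤s z≤n) 2≤x)))
    (x∉p∪q⁺ (toℕ≢⇒∉⁅fromℕ<⁆ 1<n (>⇒≢ 2≤x)) (toℕ≢⇒∉⁅fromℕ<⁆ 3+g<n x≢3+g))
  avoid-low : AvoidsInterval S 2 (3 + g)
  avoid-low z 2≤z z<3+g = on-S 2≤z (<⇒≢ z<3+g)
  avoid-high : AvoidsInterval S (4 + g) n
  avoid-high z 4+g≤z _ = on-S (≤-trans (s≤s (s≤s z≤n)) 4+g≤z) (>⇒≢ 4+g≤z)
  cutset : IsCutset (Wheel n) S
  cutset = fromℕ< 2<n , fromℕ< 4+g<n ,
    avoid-low _ (≤-reflexive (sym (toℕ-fromℕ< 2<n))) (subst (_< 3 + g) (sym (toℕ-fromℕ< 2<n)) (s≤s (s≤s (s≤s z≤n)))) ,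
    avoid-high _ (≤-reflexive (sym (toℕ-fromℕ< 4+g<n))) (toℕ<n _) ,
    separated-below (3 + g)
      (λ x∉S w∉S e → step-stays-below (wheel-rim-adjacent (proj₁ (off-S x∉S)) (proj₁ (off-S w∉S)) e) (proj₂ (off-S w∉S)))
      (subst (_< 3 + g) (sym (toℕ-fromℕ< 2<n)) (s≤s (s≤s (s≤s z≤n))))
      (subst (3 + g ≤_) (sym (toℕ-fromℕ< 4+g<n)) (n≤1+n _))
  components : ∀ x → x ∉ S → ComponentAtLeast (Wheel n) S x (suc g)
  components x x∉S with toℕ x <? 3 + g
  ... | yes x<3+g = interval-component wheel-consecutive wheel-sym (s≤s z≤n) ≤-refl (<⇒≤ 3+g<n) avoid-low
    (proj₁ (off-S x∉S)) x<3+g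
  ... | no x≮3+g = interval-component wheel-consecutive wheel-sym (s≤s z≤n) room ≤-refl avoid-high
    (≤∧≢⇒< (≮⇒≥ x≮3+g) (proj₂ (off-S x∉S) ∘ sym)) (toℕ<n x)
  size : ∣ S ∣ ≤ 3
  size = ≤-trans (∣p∪q∣≤∣p∣+∣q∣ ⁅ fromℕ< 0<n ⁆ _) (+-mono-≤ (≤-reflexive (∣⁅x⁆∣≡1 (fromℕ< 0<n)))
    (≤-trans (∣p∪q∣≤∣p∣+∣q∣ ⁅ fromℕ< 1<n ⁆ ⁅ fromℕ< 3+g<n ⁆)
      (≤-reflexive (cong₂ _+_ (∣⁅x⁆∣≡1 (fromℕ< 1<n)) (∣⁅x⁆∣≡1 (fromℕ< 3+g<n))))))

-- From cutset bounds to the threshold for g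

m≤n/o⇔m*o≤n : ∀ m n o .{{_ : NonZero o}} → m ≤ n / o ⇔ m * o ≤ n
m≤n/o⇔m*o≤n m n o = mk⇔
  (λ m≤n/o → ≤-trans (*-monoˡ-≤ o m≤n/o) (m/n*n≤m n o))
  (λ m*o≤n → subst (_≤ n / o) (m*n/n≡m m o) (/-monoˡ-≤ o m*o≤n))

m≤o∸n⇔m+n≤o : ∀ m {n o} → n ≤ o → m ≤ o ∸ n ⇔ m + n ≤ o
m≤o∸n⇔m+n≤o m n≤o = mk⇔ (m≤o∸n⇒m+n≤o m n≤o) (m+n≤o⇒m≤o∸n m)

≤half⇔room : ∀ g s n → 2 + s ≤ n → g ≤ (n ∸ (2 + s)) / 2 ⇔ s + (suc g + suc g) ≤ n
≤half⇔room g s n 2+s≤n =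
  subst (λ k → g * 2 ≤ n ∸ (2 + s) ⇔ k ≤ n) (rearrange g s) (m≤o∸n⇔m+n≤o (g * 2) 2+s≤n)
    ⇔-∘ m≤n/o⇔m*o≤n g (n ∸ (2 + s)) 2
  where
  rearrange : ∀ g s → g * 2 + (2 + s) ≡ s + (suc g + suc g)
  rearrange = solve-∀

module _ {n : ℕ} (G : Graph n) (G-sym : Symmetric G) (s : ℕ)
         (cutset-size : ∀ S → IsCutset G S → s ≤ ∣ S ∣)
         (rgCutset-of-size : ∀ g → s + (suc g + suc g) ≤ n →
           Σ[ S ∈ Subset n ] IsRgCutset G g S × ∣ S ∣ ≤ s)
         where

  rgCutset⇒room : ∀ {g S} → IsRgCutset G g S → s + (suc g + suc g) ≤ n
  rgCutset⇒room {g} {S} rg = subst (_≤ n) (+-comm (suc g + suc g) s)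
    (m≤o∸n⇒m+n≤o _ (≤-trans s≤∣S∣ (∣p∣≤n S))
      (≤-trans (rgCutset⇒2[1+g]≤∣∁S∣ G-sym rg)
        (≤-trans (≤-reflexive (∣∁p∣≡n∸∣p∣ S)) (∸-monoʳ-≤ n s≤∣S∣))))
    where
    s≤∣S∣ : s ≤ ∣ S ∣
    s≤∣S∣ = cutset-size S (proj₁ rg)

  hasRgCutset⇔room : ∀ g → HasRgCutset G g ⇔ s + (suc g + suc g) ≤ n
  hasRgCutset⇔room g = mk⇔ (rgCutset⇒room ∘ proj₂)
    (λ room → let (S , rg , _) = rgCutset-of-size g room in S , rg)

  kappa-room : ∀ g → s + (suc g + suc g) ≤ n → KappaIs G g s
  kappa-room g room with rgCutset-of-size g room
  ... | S , rg , ∣S∣≤s = (S , rg , ≤-antisym ∣S∣≤s (cutset-size S (proj₁ rg))) ,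
                         (λ S′ rg′ → cutset-size S′ (proj₁ rg′))

  rgCutset-threshold : 2 + s ≤ n → ∀ g →
    (HasRgCutset G g ⇔ g ≤ (n ∸ (2 + s)) / 2) × (g ≤ (n ∸ (2 + s)) / 2 → KappaIs G g s)
  rgCutset-threshold 2+s≤n g =
    ⇔-sym (≤half⇔room g s n 2+s≤n) ⇔-∘ hasRgCutset⇔room g ,
    kappa-room g ∘ Equivalence.to (≤half⇔room g s n 2+s≤n)

proposition2p3 : (g : ℕ) →
    ((n : ℕ) → 5 ≤ n →
      (HasRgCutset (Wheel n) g ⇔ (g ≤ (n ∸ 5) / 2)) ×
      (g ≤ (n ∸ 5) / 2 → KappaIs (Wheel n) g 3)) ×
    ((n : ℕ) → 3 ≤ n →
      (HasRgCutset (PathG n) g ⇔ (g ≤ (n ∸ 3) / 2)) ×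
      (g ≤ (n ∸ 3) / 2 → KappaIs (PathG n) g 1))
proposition2p3 g =
  (λ n 5≤n → rgCutset-threshold (Wheel n) wheel-sym 3 wheel-cutset-size wheel-rgCutset 5≤n g) ,
  (λ n 3≤n → rgCutset-threshold (PathG n) path-sym 1 path-cutset-size path-rgCutset 3≤n g)
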